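{- Let $J$ be a symmetric $\Delta\times\Delta$ matrix with non-negative integer entries such that $n_\alpha:=\frac{1}{\alpha}\big(J_{\alpha\alpha}+\sum_{\beta=1}^{\Delta}J_{\alpha\beta}\big)$ is a non-negative integer for every $1\le\alpha\le\Delta$, and let the node set be the disjoint union $V_1\cup\dots\cup V_\Delta$ with $|V_\alpha|=n_\alpha$. Let $\mathcal{S}$ be a subset of the nodes, and for each node $i\in\mathcal{S}$, say $i\in V_\alpha$, let a degree spectrum $s_i=(s_i(1),\dots,s_i(\Delta))$ of non-negative integers with $\sum_{\beta}s_i(\beta)=\alpha$ be fixed. Then there exists a realization of $J$ in which every node $i\in\mathcal{S}$ has degree spectrum $s_i$ if and only if for every pair $(\alpha,\beta)$ with $\alpha,\beta\in\{1,\dots,\Delta\}$ there exists a graph $G_{\alpha\beta}$ with $J_{\alpha\beta}$ edges satisfying the fixed spectra of $\mathcal{S}$.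
   Context: A realization of $J$ is a simple graph on $V_1\cup\dots\cup V_\Delta$ in which every node of $V_\alpha$ has degree $\alpha$, for $\alpha\neq\beta$ exactly $J_{\alpha\beta}$ edges join a node of $V_\alpha$ to a node of $V_\beta$, and exactly $J_{\alpha\alpha}$ edges have both endpoints in $V_\alpha$. The degree spectrum of a node $i$ in a graph is the vector whose $\beta$-th entry is the number of neighbours of $i$ in $V_\beta$. For $\alpha\neq\beta$, a graph $G_{\alpha\beta}$ with $J_{\alpha\beta}$ edges satisfying the fixed spectra of $\mathcal{S}$ means a simple bipartite graph with parts $V_\alpha$ and $V_\beta$ having exactly $J_{\alpha\beta}$ edges, in which each $i\in\mathcal{S}\cap V_\alpha$ has exactly $s_i(\beta)$ neighbours and each $i\in\mathcal{S}\cap V_\beta$ has exactly $s_i(\alpha)$ neighbours; for $\alpha=\beta$ it means a simple graph on $V_\alpha$ with exactly $J_{\alpha\alpha}$ edges in which each $i\in\mathcal{S}\cap V_\alpha$ has degree $s_i(\alpha)$. -}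

module Defs where

open import Data.Nat using (ℕ; zero; suc; _+_; _*_)
open import Data.Fin using (Fin; zero; suc; toℕ)
open import Data.Bool using (Bool; true; false)
open import Data.Product using (Σ; ∃; _×_)
open import Relation.Binary.PropositionalEquality using (_≡_; _≢_)

∑ : (n : ℕ) → (Fin n → ℕ) → ℕ
∑ zero    f = 0
∑ (suc n) f = f zero + ∑ n (λ i → f (suc i))

⟦_⟧ : Bool → ℕ
⟦ true  ⟧ = 1
⟦ false ⟧ = 0

-- Classes are indexed by Fin Δ; the class α : Fin Δ stands for the paper's
-- degree class  toℕ α + 1 ∈ {1,…,Δ}.
deg : {Δ : ℕ} → Fin Δ → ℕ
deg α = suc (toℕ α)

module _ {Δ : ℕ} (J : Fin Δ → Fin Δ → ℕ) (n : Fin Δ → ℕ) where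

  Adj : Set
  Adj = (α β : Fin Δ) → Fin (n α) → Fin (n β) → Bool

  IsSimple : Adj → Set
  IsSimple A = (∀ α β i j → A α β i j ≡ A β α j i) × (∀ α i → A α α i i ≡ false)

  spectrum : Adj → (α : Fin Δ) → Fin (n α) → Fin Δ → ℕ
  spectrum A α i β = ∑ (n β) (λ j → ⟦ A α β i j ⟧)

  cross : Adj → Fin Δ → Fin Δ → ℕ
  cross A α β = ∑ (n α) (λ i → ∑ (n β) (λ j → ⟦ A α β i j ⟧))

  -- realization of J (edges inside V_α are counted twice by cross)
  IsRealization : Adj → Set
  IsRealization A =
    IsSimple A
    × (∀ α i → ∑ Δ (spectrum A α i) ≡ deg α)
    × (∀ α β → α ≢ β → cross A α β ≡ J α β)
    × (∀ α → cross A α α ≡ 2 * J α α)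

  module _ (S : (α : Fin Δ) → Fin (n α) → Set)
           (s : (α : Fin Δ) (i : Fin (n α)) → S α i → Fin Δ → ℕ) where

    RealizesWithSpectra : Adj → Set
    RealizesWithSpectra A =
      IsRealization A × (∀ α i (p : S α i) β → spectrum A α i β ≡ s α i p β)

    BipartiteOK : (α β : Fin Δ) → (Fin (n α) → Fin (n β) → Bool) → Set
    BipartiteOK α β B =
      ∑ (n α) (λ i → ∑ (n β) (λ j → ⟦ B i j ⟧)) ≡ J α β
      × (∀ i (p : S α i) → ∑ (n β) (λ j → ⟦ B i j ⟧) ≡ s α i p β)
      × (∀ j (p : S β j) → ∑ (n α) (λ i → ⟦ B i j ⟧) ≡ s β j p α)

    -- α = β: simple graph on V_α with J_αα edges satisfying the fixed spectra
    -- (sum of degrees = 2 · number of edges)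
    InternalOK : (α : Fin Δ) → (Fin (n α) → Fin (n α) → Bool) → Set
    InternalOK α G =
      (∀ i j → G i j ≡ G j i)
      × (∀ i → G i i ≡ false)
      × ∑ (n α) (λ i → ∑ (n α) (λ j → ⟦ G i j ⟧)) ≡ 2 * J α α
      × (∀ i (p : S α i) → ∑ (n α) (λ j → ⟦ G i j ⟧) ≡ s α i p α)

    LocalGraphExists : (α β : Fin Δ) → Set
    LocalGraphExists α β =
      (α ≢ β → ∃ (BipartiteOK α β))
      × (α ≡ β → ∃ (InternalOK α))

-- Restricting a realization to each pair of classes gives the local graphs. Conversely,
-- gluing the local graphs gives a simple graph with the right edge count between every two
-- classes and the prescribed spectra on S, in which only nodes outside S can have the wrong
-- degree. The edge counts fix the degree total of every class, so a node u of too high degree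
-- comes with a node v of the same class with too low degree. Then u has more neighbours than
-- v in some class V_β, hence some w ∈ V_β is adjacent to u but not to v. Moving the edge uw
-- to vw keeps every edge count, keeps the spectra on S (u, v ∉ S, and w trades a neighbour
-- for another of the same class), and lowers the total excess ∑ (degree ∸ α) by one.

module Submission where

open import Data.Bool using (Bool; true; false; _∧_; _∨_; not; if_then_else_)
open import Data.Bool.Properties using (∧-comm; ∨-comm; ∧-zeroʳ; ∧-identityʳ; ∧-conicalˡ; ∧-conicalʳ)
open import Data.Empty using (⊥-elim)
open import Data.Fin using (Fin; zero; suc)
import Data.Fin.Properties as Fin
open import Data.Nat using (ℕ; zero; suc; _+_; _*_; _∸_; _≤_; _<_; z≤n; s≤s; z<s)
open import Data.Nat.Properties hiding (_≟_)
open import Data.Nat.Tactic.RingSolver using (solve-∀)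
open import Data.Product using (Σ; ∃; _×_; _,_; proj₁; proj₂)
open import Data.Product.Properties using (≡-dec)
open import Data.Sum using (_⊎_; inj₁; inj₂)
open import Function using (_∘_; flip; case_of_)
open import Function.Bundles using (_⇔_; mk⇔)
open import Relation.Binary using (DecidableEquality; tri<; tri≈; tri>)
open import Relation.Binary.PropositionalEquality
  using (_≡_; _≢_; ≢-sym; refl; sym; trans; cong; cong₂; subst; subst₂; module ≡-Reasoning)
open import Relation.Nullary using (Dec; yes; no; does)
open import Relation.Nullary.Decidable using (dec-true; dec-false)

open import Defs

open ≡-Reasoning

∑-cong : ∀ m {f g : Fin m → ℕ} → (∀ i → f i ≡ g i) → ∑ m f ≡ ∑ m g
∑-cong zero    f≗g = refl
∑-cong (suc m) f≗g = cong₂ _+_ (f≗g zero) (∑-cong m (f≗g ∘ suc))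

∑-zero : ∀ m → ∑ m (λ _ → 0) ≡ 0
∑-zero zero    = refl
∑-zero (suc m) = ∑-zero m

∑-const : ∀ m c → ∑ m (λ _ → c) ≡ m * c
∑-const zero    c = refl
∑-const (suc m) c = cong (c +_) (∑-const m c)

∑-distrib-+ : ∀ m (f g : Fin m → ℕ) → ∑ m (λ i → f i + g i) ≡ ∑ m f + ∑ m g
∑-distrib-+ zero    f g = refl
∑-distrib-+ (suc m) f g = begin
  f zero + g zero + ∑ m (λ i → f (suc i) + g (suc i))
    ≡⟨ cong (f zero + g zero +_) (∑-distrib-+ m (f ∘ suc) (g ∘ suc)) ⟩
  f zero + g zero + (∑ m (f ∘ suc) + ∑ m (g ∘ suc))
    ≡⟨ interchange (f zero) (g zero) _ _ ⟩
  f zero + ∑ m (f ∘ suc) + (g zero + ∑ m (g ∘ suc)) ∎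
  where
  interchange : ∀ a b c d → a + b + (c + d) ≡ a + c + (b + d)
  interchange = solve-∀

∑-distribˡ-* : ∀ m c (f : Fin m → ℕ) → ∑ m (λ i → c * f i) ≡ c * ∑ m f
∑-distribˡ-* zero    c f = sym (*-zeroʳ c)
∑-distribˡ-* (suc m) c f =
  trans (cong (c * f zero +_) (∑-distribˡ-* m c (f ∘ suc))) (sym (*-distribˡ-+ c (f zero) _))

∑-distribʳ-* : ∀ m c (f : Fin m → ℕ) → ∑ m (λ i → f i * c) ≡ ∑ m f * c
∑-distribʳ-* m c f =
  trans (∑-cong m (λ i → *-comm (f i) c)) (trans (∑-distribˡ-* m c f) (*-comm c (∑ m f)))

∑-comm : ∀ m k (f : Fin m → Fin k → ℕ) →
         ∑ m (λ i → ∑ k (f i)) ≡ ∑ k (λ j → ∑ m (λ i → f i j))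
∑-comm zero    k f = sym (∑-zero k)
∑-comm (suc m) k f =
  trans (cong (∑ k (f zero) +_) (∑-comm m k (f ∘ suc))) (sym (∑-distrib-+ k (f zero) _))

∑-balance : ∀ m {f f′ g : Fin m → ℕ} {G} a b → ∑ m g ≡ G →
          (∀ i → f′ i + a * g i ≡ f i + b * g i) → ∑ m f′ + a * G ≡ ∑ m f + b * G
∑-balance m {f} {f′} {g} {G} a b ∑g≡G pointwise = begin
  ∑ m f′ + a * G                  ≡⟨ cong (λ t → ∑ m f′ + a * t) ∑g≡G ⟨
  ∑ m f′ + a * ∑ m g              ≡⟨ cong (∑ m f′ +_) (∑-distribˡ-* m a g) ⟨
  ∑ m f′ + ∑ m (λ i → a * g i)    ≡⟨ ∑-distrib-+ m f′ _ ⟨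
  ∑ m (λ i → f′ i + a * g i)      ≡⟨ ∑-cong m pointwise ⟩
  ∑ m (λ i → f i + b * g i)       ≡⟨ ∑-distrib-+ m f _ ⟩
  ∑ m f + ∑ m (λ i → b * g i)     ≡⟨ cong (∑ m f +_) (∑-distribˡ-* m b g) ⟩
  ∑ m f + b * ∑ m g               ≡⟨ cong (λ t → ∑ m f + b * t) ∑g≡G ⟩
  ∑ m f + b * G                   ∎

∑-mono-≤ : ∀ m {f g : Fin m → ℕ} → (∀ i → f i ≤ g i) → ∑ m f ≤ ∑ m g
∑-mono-≤ zero    f≤g = z≤n
∑-mono-≤ (suc m) f≤g = +-mono-≤ (f≤g zero) (∑-mono-≤ m (f≤g ∘ suc))

∑-mono-< : ∀ m {f g : Fin m → ℕ} → (∀ i → f i ≤ g i) → ∀ k → f k < g k → ∑ m f < ∑ m g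
∑-mono-< (suc m) f≤g zero    fk<gk = +-mono-<-≤ fk<gk (∑-mono-≤ m (f≤g ∘ suc))
∑-mono-< (suc m) f≤g (suc k) fk<gk = +-mono-≤-< (f≤g zero) (∑-mono-< m (f≤g ∘ suc) k fk<gk)

∑-term-≤ : ∀ m (f : Fin m → ℕ) k → f k ≤ ∑ m f
∑-term-≤ (suc m) f zero    = m≤m+n (f zero) _
∑-term-≤ (suc m) f (suc k) = ≤-trans (∑-term-≤ m (f ∘ suc) k) (m≤n+m _ (f zero))

∑-≡-pointwise : ∀ m {f g : Fin m → ℕ} → (∀ i → f i ≤ g i) → ∑ m f ≡ ∑ m g → ∀ i → f i ≡ g i
∑-≡-pointwise m f≤g ∑f≡∑g i with m≤n⇒m<n∨m≡n (f≤g i)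
... | inj₂ fi≡gi = fi≡gi
... | inj₁ fi<gi = ⊥-elim (<-irrefl ∑f≡∑g (∑-mono-< m f≤g i fi<gi))

∃<⊎∀≥ : ∀ m (f g : Fin m → ℕ) → (∃ λ k → f k < g k) ⊎ (∀ k → g k ≤ f k)
∃<⊎∀≥ m f g with Fin.any? (λ k → f k <? g k)
... | yes ∃f<g = inj₁ ∃f<g
... | no ∄f<g  = inj₂ (λ k → ≮⇒≥ (λ fk<gk → ∄f<g (k , fk<gk)))

∑-<⇒∃< : ∀ m (f g : Fin m → ℕ) → ∑ m f < ∑ m g → ∃ λ k → f k < g k
∑-<⇒∃< m f g ∑f<∑g with ∃<⊎∀≥ m f g
... | inj₁ ∃f<g = ∃f<g
... | inj₂ g≤f  = ⊥-elim (<⇒≱ ∑f<∑g (∑-mono-≤ m g≤f))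

∑-≡⇒∃< : ∀ m (f g : Fin m → ℕ) → ∑ m f ≡ ∑ m g → ∀ k → g k < f k → ∃ λ j → f j < g j
∑-≡⇒∃< m f g ∑f≡∑g k gk<fk with ∃<⊎∀≥ m f g
... | inj₁ ∃f<g = ∃f<g
... | inj₂ g≤f  = ⊥-elim (<-irrefl (∑-≡-pointwise m g≤f (sym ∑f≡∑g) k) gk<fk)

∑-pos⇒∃pos : ∀ m (f : Fin m → ℕ) → 0 < ∑ m f → ∃ λ k → 0 < f k
∑-pos⇒∃pos m f 0<∑f = ∑-<⇒∃< m (λ _ → 0) f (subst (_< ∑ m f) (sym (∑-zero m)) 0<∑f)

kron : {A : Set} → DecidableEquality A → A → A → ℕ
kron _≟_ x y = ⟦ does (x ≟ y) ⟧

kron-refl : {A : Set} (_≟_ : DecidableEquality A) (x : A) → kron _≟_ x x ≡ 1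
kron-refl _≟_ x = cong ⟦_⟧ (dec-true (x ≟ x) refl)

kron-≢ : {A : Set} (_≟_ : DecidableEquality A) {x y : A} → x ≢ y → kron _≟_ x y ≡ 0
kron-≢ _≟_ x≢y = cong ⟦_⟧ (dec-false (_ ≟ _) x≢y)

not-does⇒≢ : {A : Set} (_≟_ : DecidableEquality A) {x y : A} → not (does (x ≟ y)) ≡ true → x ≢ y
not-does⇒≢ _≟_ {x} {y} x≉y x≡y = case trans (sym (cong not (dec-true (x ≟ y) x≡y))) x≉y of λ ()

δᶠ : ∀ {m} → Fin m → Fin m → ℕ
δᶠ = kron Fin._≟_

∑-δᶠ : ∀ m (k : Fin m) → ∑ m (λ j → δᶠ j k) ≡ 1
∑-δᶠ (suc m) zero    = cong suc (∑-zero m)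
∑-δᶠ (suc m) (suc k) = ∑-δᶠ m k

⟦⟧-< : ∀ {a b} → ⟦ a ⟧ < ⟦ b ⟧ → a ≡ false × b ≡ true
⟦⟧-< {false} {true} _ = refl , refl
⟦⟧-< {true}  {true} (s≤s ())

-- Deleting one edge and then inserting another shifts a count down by p + r
-- and up by q + r, where r is the contribution of the common endpoint.
remove-add : ∀ {f f₁ f₂} p q r → f₁ + 1 * (p + r) ≡ f + 0 * (p + r) →
             f₂ + 0 * (q + r) ≡ f₁ + 1 * (q + r) → f₂ + p ≡ f + q
remove-add {f} {f₁} {f₂} p q r removed added = +-cancelʳ-≡ r _ _ (begin
  f₂ + p + r                       ≡⟨ regroup₁ f₂ p q r ⟩
  f₂ + 0 * (q + r) + 1 * (p + r)   ≡⟨ cong (_+ 1 * (p + r)) added ⟩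
  f₁ + 1 * (q + r) + 1 * (p + r)   ≡⟨ regroup₂ f₁ p q r ⟩
  f₁ + 1 * (p + r) + (q + r)       ≡⟨ cong (_+ (q + r)) removed ⟩
  f + 0 * (p + r) + (q + r)        ≡⟨ regroup₃ f p q r ⟩
  f + q + r                        ∎)
  where
  regroup₁ : ∀ a p q r → a + p + r ≡ a + 0 * (q + r) + 1 * (p + r)
  regroup₁ = solve-∀
  regroup₂ : ∀ a p q r → a + 1 * (q + r) + 1 * (p + r) ≡ a + 1 * (p + r) + (q + r)
  regroup₂ = solve-∀
  regroup₃ : ∀ a p q r → a + 0 * (p + r) + (q + r) ≡ a + q + r
  regroup₃ = solve-∀

∸-step-above : ∀ {d D D′} → d < D → D′ + 1 ≡ D + 0 → D′ ∸ d + 1 ≡ D ∸ d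
∸-step-above {d} {D} {D′} d<D D′+1≡D = begin
  D′ ∸ d + 1   ≡⟨ +-∸-comm 1 (≤-pred (subst (d <_) D≡1+D′ d<D)) ⟨
  D′ + 1 ∸ d   ≡⟨ cong (_∸ d) (trans D′+1≡D (+-identityʳ D)) ⟩
  D ∸ d        ∎
  where
  D≡1+D′ : D ≡ suc D′
  D≡1+D′ = trans (sym (+-identityʳ D)) (trans (sym D′+1≡D) (+-comm D′ 1))

∸-step-below : ∀ {d D D′} → D < d → D′ + 0 ≡ D + 1 → D′ ∸ d + 0 ≡ D ∸ d
∸-step-below {d} {D} {D′} D<d D′≡D+1 = begin
  D′ ∸ d + 0   ≡⟨ cong (_+ 0) (m≤n⇒m∸n≡0 D′≤d) ⟩
  0            ≡⟨ m≤n⇒m∸n≡0 (<⇒≤ D<d) ⟨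
  D ∸ d        ∎
  where
  D′≤d : D′ ≤ d
  D′≤d = subst (_≤ d) (sym (trans (sym (+-identityʳ D′)) (trans D′≡D+1 (+-comm D 1)))) D<d

module _ {Δ : ℕ} (J : Fin Δ → Fin Δ → ℕ) (n : Fin Δ → ℕ) where

  Node : Set
  Node = Σ (Fin Δ) (λ α → Fin (n α))

  _≟ᴺ_ : DecidableEquality Node
  _≟ᴺ_ = ≡-dec Fin._≟_ Fin._≟_

  δᴺ : Node → Node → ℕ
  δᴺ = kron _≟ᴺ_

  ∑-δᴺ : ∀ β (y : Node) → ∑ (n β) (λ j → δᴺ (β , j) y) ≡ δᶠ β (proj₁ y)
  ∑-δᴺ β (γ , w) with β Fin.≟ γ
  ... | no _     = ∑-zero (n β)
  ... | yes refl = ∑-δᶠ (n β) w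

  ∑ᴺ : (Node → ℕ) → ℕ
  ∑ᴺ f = ∑ Δ (λ γ → ∑ (n γ) (λ i → f (γ , i)))

  ∑ᴺ-cong : ∀ {f g : Node → ℕ} → (∀ z → f z ≡ g z) → ∑ᴺ f ≡ ∑ᴺ g
  ∑ᴺ-cong f≗g = ∑-cong Δ (λ γ → ∑-cong (n γ) (λ i → f≗g (γ , i)))

  ∑ᴺ-distrib-+ : ∀ (f g : Node → ℕ) → ∑ᴺ (λ z → f z + g z) ≡ ∑ᴺ f + ∑ᴺ g
  ∑ᴺ-distrib-+ f g =
    trans (∑-cong Δ (λ γ → ∑-distrib-+ (n γ) _ _)) (∑-distrib-+ Δ _ _)

  ∑ᴺ-δᴺ : ∀ y → ∑ᴺ (λ z → δᴺ z y) ≡ 1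
  ∑ᴺ-δᴺ y = trans (∑-cong Δ (λ γ → ∑-δᴺ γ y)) (∑-δᶠ Δ (proj₁ y))

  edge : Adj J n → Node → Node → Bool
  edge A (α , i) (β , j) = A α β i j

  degree : Adj J n → Node → ℕ
  degree A z = ∑ Δ (spectrum J n A (proj₁ z) (proj₂ z))

  excess : Adj J n → Node → ℕ
  excess A z = degree A z ∸ deg (proj₁ z)

  total-excess : Adj J n → ℕ
  total-excess A = ∑ᴺ (excess A)

  _[_─_]≔_ : Adj J n → Node → Node → Bool → Adj J n
  (A [ x ─ y ]≔ b) α β i j =
    if does ((α , i) ≟ᴺ x) ∧ does ((β , j) ≟ᴺ y) ∨ does ((α , i) ≟ᴺ y) ∧ does ((β , j) ≟ᴺ x)
    then b else A α β i j

  -- The number of orientations of {x, y} equal to (z , z′).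
  pairs : Node → Node → Node → Node → ℕ
  pairs x y z z′ = δᴺ z x * δᴺ z′ y + δᴺ z y * δᴺ z′ x

  module _ (A : Adj J n) (simple : IsSimple J n A) {x y : Node} (x≢y : x ≢ y)
           {a : Bool} (xy≡a : edge A x y ≡ a) (b : Bool) where

    private
      swap-weights : ∀ {e} → e ≡ a → ⟦ b ⟧ + ⟦ a ⟧ * 1 ≡ ⟦ e ⟧ + ⟦ b ⟧ * 1
      swap-weights refl = swap ⟦ b ⟧ ⟦ a ⟧
        where
        swap : ∀ u v → u + v * 1 ≡ v + u * 1
        swap = solve-∀

      zero-weights : ∀ {e} → ⟦ e ⟧ + ⟦ a ⟧ * 0 ≡ ⟦ e ⟧ + ⟦ b ⟧ * 0
      zero-weights {e} = cong (⟦ e ⟧ +_) (trans (*-zeroʳ ⟦ a ⟧) (sym (*-zeroʳ ⟦ b ⟧)))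

    edge-update : ∀ z z′ → ⟦ edge (A [ x ─ y ]≔ b) z z′ ⟧ + ⟦ a ⟧ * pairs x y z z′
                           ≡ ⟦ edge A z z′ ⟧ + ⟦ b ⟧ * pairs x y z z′
    edge-update (α , i) (β , j)
      with (α , i) ≟ᴺ x | (β , j) ≟ᴺ y | (α , i) ≟ᴺ y | (β , j) ≟ᴺ x
    ... | yes refl | yes refl | yes x≡y  | _         = ⊥-elim (x≢y x≡y)
    ... | yes refl | yes refl | no _     | yes y≡x   = ⊥-elim (x≢y (sym y≡x))
    ... | yes refl | yes refl | no _     | no _      = swap-weights xy≡a
    ... | yes refl | no _     | yes x≡y  | _         = ⊥-elim (x≢y x≡y)
    ... | yes _    | no _     | no _     | _         = zero-weights
    ... | no _     | _        | yes refl | yes refl  = swap-weights (trans (proj₁ simple α β i j) xy≡a)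
    ... | no _     | _        | yes _    | no _      = zero-weights
    ... | no _     | _        | no _     | _         = zero-weights

    update-elsewhere : ∀ {z} z′ → z ≢ x → z ≢ y → edge (A [ x ─ y ]≔ b) z z′ ≡ edge A z z′
    update-elsewhere {α , i} (β , j) z≢x z≢y with (α , i) ≟ᴺ x | (α , i) ≟ᴺ y
    ... | yes z≡x | _       = ⊥-elim (z≢x z≡x)
    ... | no _    | yes z≡y = ⊥-elim (z≢y z≡y)
    ... | no _    | no _    = refl

    update-simple : IsSimple J n (A [ x ─ y ]≔ b)
    update-simple = update-sym , update-loopless
      where
      flip-condition : ∀ p q r s → p ∧ q ∨ r ∧ s ≡ s ∧ r ∨ q ∧ p
      flip-condition p q r s = trans (∨-comm (p ∧ q) (r ∧ s)) (cong₂ _∨_ (∧-comm r s) (∧-comm p q))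

      update-sym : ∀ α β i j → (A [ x ─ y ]≔ b) α β i j ≡ (A [ x ─ y ]≔ b) β α j i
      update-sym α β i j =
        cong₂ (λ c e → if c then b else e)
              (flip-condition (does ((α , i) ≟ᴺ x)) (does ((β , j) ≟ᴺ y)) (does ((α , i) ≟ᴺ y)) (does ((β , j) ≟ᴺ x)))
              (proj₁ simple α β i j)

      update-loopless : ∀ α i → (A [ x ─ y ]≔ b) α α i i ≡ false
      update-loopless α i with (α , i) ≟ᴺ x | (α , i) ≟ᴺ y
      ... | yes refl | yes refl = ⊥-elim (x≢y refl)
      ... | yes _    | no _     = proj₂ simple α i
      ... | no _     | yes _    = proj₂ simple α i
      ... | no _     | no _     = proj₂ simple α i

    spectrum-update : ∀ α i β →
      spectrum J n (A [ x ─ y ]≔ b) α i β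
        + ⟦ a ⟧ * (δᴺ (α , i) x * δᶠ β (proj₁ y) + δᴺ (α , i) y * δᶠ β (proj₁ x))
      ≡ spectrum J n A α i β
        + ⟦ b ⟧ * (δᴺ (α , i) x * δᶠ β (proj₁ y) + δᴺ (α , i) y * δᶠ β (proj₁ x))
    spectrum-update α i β =
      ∑-balance (n β) ⟦ a ⟧ ⟦ b ⟧ ∑-pairs (λ j → edge-update (α , i) (β , j))
      where
      ∑-pairs : ∑ (n β) (λ j → pairs x y (α , i) (β , j))
                ≡ δᴺ (α , i) x * δᶠ β (proj₁ y) + δᴺ (α , i) y * δᶠ β (proj₁ x)
      ∑-pairs = trans (∑-distrib-+ (n β) _ _) (cong₂ _+_
        (trans (∑-distribˡ-* (n β) (δᴺ (α , i) x) (λ j → δᴺ (β , j) y)) (cong (δᴺ (α , i) x *_) (∑-δᴺ β y)))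
        (trans (∑-distribˡ-* (n β) (δᴺ (α , i) y) (λ j → δᴺ (β , j) x)) (cong (δᴺ (α , i) y *_) (∑-δᴺ β x))))

    degree-update : ∀ z → degree (A [ x ─ y ]≔ b) z + ⟦ a ⟧ * (δᴺ z x + δᴺ z y)
                          ≡ degree A z + ⟦ b ⟧ * (δᴺ z x + δᴺ z y)
    degree-update (α , i) = ∑-balance Δ ⟦ a ⟧ ⟦ b ⟧ ∑-weights (spectrum-update α i)
      where
      ∑-weights : ∑ Δ (λ β → δᴺ (α , i) x * δᶠ β (proj₁ y) + δᴺ (α , i) y * δᶠ β (proj₁ x))
                  ≡ δᴺ (α , i) x + δᴺ (α , i) y
      ∑-weights = trans (∑-distrib-+ Δ _ _) (cong₂ _+_
        (trans (∑-distribˡ-* Δ (δᴺ (α , i) x) (λ β → δᶠ β (proj₁ y)))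
               (trans (cong (δᴺ (α , i) x *_) (∑-δᶠ Δ (proj₁ y))) (*-identityʳ (δᴺ (α , i) x))))
        (trans (∑-distribˡ-* Δ (δᴺ (α , i) y) (λ β → δᶠ β (proj₁ x)))
               (trans (cong (δᴺ (α , i) y *_) (∑-δᶠ Δ (proj₁ x))) (*-identityʳ (δᴺ (α , i) y)))))

    cross-update : ∀ γ δ →
      cross J n (A [ x ─ y ]≔ b) γ δ
        + ⟦ a ⟧ * (δᶠ γ (proj₁ x) * δᶠ δ (proj₁ y) + δᶠ γ (proj₁ y) * δᶠ δ (proj₁ x))
      ≡ cross J n A γ δ
        + ⟦ b ⟧ * (δᶠ γ (proj₁ x) * δᶠ δ (proj₁ y) + δᶠ γ (proj₁ y) * δᶠ δ (proj₁ x))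
    cross-update γ δ = ∑-balance (n γ) ⟦ a ⟧ ⟦ b ⟧ ∑-weights (λ i → spectrum-update γ i δ)
      where
      ∑-weights : ∑ (n γ) (λ i → δᴺ (γ , i) x * δᶠ δ (proj₁ y) + δᴺ (γ , i) y * δᶠ δ (proj₁ x))
                  ≡ δᶠ γ (proj₁ x) * δᶠ δ (proj₁ y) + δᶠ γ (proj₁ y) * δᶠ δ (proj₁ x)
      ∑-weights = trans (∑-distrib-+ (n γ) _ _) (cong₂ _+_
        (trans (∑-distribʳ-* (n γ) (δᶠ δ (proj₁ y)) (λ i → δᴺ (γ , i) x)) (cong (_* δᶠ δ (proj₁ y)) (∑-δᴺ γ x)))
        (trans (∑-distribʳ-* (n γ) (δᶠ δ (proj₁ x)) (λ i → δᴺ (γ , i) y)) (cong (_* δᶠ δ (proj₁ x)) (∑-δᴺ γ y))))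

  adjacent-except : Adj J n → Node → Node → (β : Fin Δ) → Fin (n β) → Bool
  adjacent-except A x y β j = edge A x (β , j) ∧ not (does ((β , j) ≟ᴺ y))

  spectrum-except : (A : Adj J n) → ∀ α i β (y : Node) →
    ∑ (n β) (λ j → ⟦ adjacent-except A (α , i) y β j ⟧) + ⟦ edge A (α , i) y ⟧ * δᶠ β (proj₁ y)
    ≡ spectrum J n A α i β
  spectrum-except A α i β y =
    trans (∑-balance (n β) ⟦ edge A (α , i) y ⟧ 0 (∑-δᴺ β y) pointwise) (+-identityʳ _)
    where
    pointwise : ∀ j → ⟦ adjacent-except A (α , i) y β j ⟧ + ⟦ edge A (α , i) y ⟧ * δᴺ (β , j) y
                      ≡ ⟦ A α β i j ⟧ + 0 * δᴺ (β , j) y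
    pointwise j with (β , j) ≟ᴺ y
    ... | yes refl = trans (cong₂ _+_ (cong ⟦_⟧ (∧-zeroʳ _)) (*-identityʳ _)) (sym (+-identityʳ _))
    ... | no _     = cong₂ _+_ (cong ⟦_⟧ (∧-identityʳ (A α β i j))) (*-zeroʳ ⟦ edge A (α , i) y ⟧)

  -- Discounting the possible edge between u and v keeps the witness w away from u and v.
  distinguishing-neighbour : (A : Adj J n) → IsSimple J n A → ∀ {α} (u v : Fin (n α)) β →
    spectrum J n A α v β < spectrum J n A α u β →
    ∃ λ w → A α β u w ≡ true × A α β v w ≡ false × (α , v) ≢ (β , w)
  distinguishing-neighbour A simple {α} u v β more = witness (∑-<⇒∃< (n β) _ _ fewer)
    where
    U V : Node
    U = α , u
    V = α , v

    fewer : ∑ (n β) (λ j → ⟦ adjacent-except A V U β j ⟧) < ∑ (n β) (λ j → ⟦ adjacent-except A U V β j ⟧)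
    fewer = +-cancelʳ-< _ _ _ (subst₂ _<_
      (sym (trans (cong (λ e → ∑ (n β) (λ j → ⟦ adjacent-except A V U β j ⟧) + ⟦ e ⟧ * δᶠ β α)
                        (sym (proj₁ simple α α v u)))
                  (spectrum-except A α v β U)))
      (sym (spectrum-except A α u β V))
      more)

    witness : (∃ λ w → ⟦ adjacent-except A V U β w ⟧ < ⟦ adjacent-except A U V β w ⟧) →
              ∃ λ w → A α β u w ≡ true × A α β v w ≡ false × V ≢ (β , w)
    witness (w , fewer-at-w) = w , uw , vw , v≢w
      where
      uw : A α β u w ≡ true
      uw = ∧-conicalˡ _ _ (proj₂ (⟦⟧-< fewer-at-w))
      v≢w : V ≢ (β , w)
      v≢w V≡W = not-does⇒≢ _≟ᴺ_ (∧-conicalʳ _ _ (proj₂ (⟦⟧-< fewer-at-w))) (sym V≡W)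
      u≢w : U ≢ (β , w)
      u≢w refl = case trans (sym uw) (proj₂ simple α u) of λ ()
      vw : A α β v w ≡ false
      vw = trans (sym (∧-identityʳ _))
                 (trans (cong (λ d → A α β v w ∧ not d) (sym (dec-false ((β , w) ≟ᴺ U) (u≢w ∘ sym))))
                        (proj₁ (⟦⟧-< fewer-at-w)))

  module _ (S : (α : Fin Δ) → Fin (n α) → Set)
           (s : (α : Fin Δ) (i : Fin (n α)) → S α i → Fin Δ → ℕ) where

    record Prerealization (A : Adj J n) : Set where
      field
        simple  : IsSimple J n A
        cross-≢ : ∀ α β → α ≢ β → cross J n A α β ≡ J α β
        cross-≡ : ∀ α → cross J n A α α ≡ 2 * J α α
        spectra : ∀ α i (p : S α i) β → spectrum J n A α i β ≡ s α i p β

    realization⇒local-graphs : ∃ (RealizesWithSpectra J n S s) → ∀ α β → LocalGraphExists J n S s α β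
    realization⇒local-graphs (A , ((simple , _ , cross-≢ , cross-≡) , spectra)) α β =
        (λ α≢β → A α β , cross-≢ α β α≢β , (λ i p → spectra α i p β)
               , (λ j p → trans (∑-cong (n α) (λ i → cong ⟦_⟧ (proj₁ simple α β i j))) (spectra β j p α)))
      , λ { refl → A α α , proj₁ simple α α , proj₂ simple α , cross-≡ α , (λ i p → spectra α i p α) }

    module Gluing (J-sym : ∀ α β → J α β ≡ J β α) (L : ∀ α β → LocalGraphExists J n S s α β) where

      bipartite : ∀ {α β} → α ≢ β → Fin (n α) → Fin (n β) → Bool
      bipartite α≢β = proj₁ (proj₁ (L _ _) α≢β)

      internal : ∀ α → Fin (n α) → Fin (n α) → Bool
      internal α = proj₁ (proj₂ (L α α) refl)

      internal-OK : ∀ α → InternalOK J n S s α (internal α)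
      internal-OK α = proj₂ (proj₂ (L α α) refl)

      -- Between two classes only the local graph of the pair with α < β is used, transposed
      -- for the reverse order, so that glue is symmetric.
      glue : Adj J n
      glue α β with Fin.<-cmp α β
      ... | tri< α<β _ _ = bipartite (Fin.<⇒≢ α<β)
      ... | tri≈ _ refl _ = internal α
      ... | tri> _ _ β<α = flip (bipartite (Fin.<⇒≢ β<α))

      BipartiteOK-flip : ∀ {α β B} → BipartiteOK J n S s β α B → BipartiteOK J n S s α β (flip B)
      BipartiteOK-flip {α} {β} (edges , β-spectra , α-spectra) =
        trans (∑-comm (n α) (n β) _) (trans edges (J-sym β α)) , α-spectra , β-spectra

      glue-≢ : ∀ {α β} → α ≢ β → BipartiteOK J n S s α β (glue α β)
      glue-≢ {α} {β} α≢β with Fin.<-cmp α β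
      ... | tri< α<β _ _  = proj₂ (proj₁ (L α β) (Fin.<⇒≢ α<β))
      ... | tri≈ _ α≡β _  = ⊥-elim (α≢β α≡β)
      ... | tri> _ _ β<α  = BipartiteOK-flip (proj₂ (proj₁ (L β α) (Fin.<⇒≢ β<α)))

      glue-≡ : ∀ α → InternalOK J n S s α (glue α α)
      glue-≡ α with Fin.<-cmp α α
      ... | tri< _ α≢α _  = ⊥-elim (α≢α refl)
      ... | tri≈ _ refl _ = internal-OK α
      ... | tri> _ α≢α _  = ⊥-elim (α≢α refl)

      glue-sym : ∀ α β i j → glue α β i j ≡ glue β α j i
      glue-sym α β i j with Fin.<-cmp α β | Fin.<-cmp β α
      ... | tri< α<β _ _  | tri> _ _ α<β′ = cong (λ p → bipartite (Fin.<⇒≢ p) i j) (Fin.<-irrelevant α<β α<β′)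
      ... | tri> _ _ β<α  | tri< β<α′ _ _ = cong (λ p → bipartite (Fin.<⇒≢ p) j i) (Fin.<-irrelevant β<α β<α′)
      ... | tri≈ _ refl _ | tri≈ _ refl _ = proj₁ (internal-OK α) i j
      ... | tri< _ _ β≮α  | tri< β<α _ _  = ⊥-elim (β≮α β<α)
      ... | tri< _ α≢β _  | tri≈ _ β≡α _  = ⊥-elim (α≢β (sym β≡α))
      ... | tri≈ _ α≡β _  | tri< _ β≢α _  = ⊥-elim (β≢α (sym α≡β))
      ... | tri≈ _ α≡β _  | tri> _ β≢α _  = ⊥-elim (β≢α (sym α≡β))
      ... | tri> _ α≢β _  | tri≈ _ β≡α _  = ⊥-elim (α≢β (sym β≡α))
      ... | tri> α≮β _ _  | tri> _ _ α<β  = ⊥-elim (α≮β α<β)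

      glue-spectra : ∀ α i (p : S α i) β → spectrum J n glue α i β ≡ s α i p β
      glue-spectra α i p β with α Fin.≟ β
      ... | yes refl = proj₂ (proj₂ (proj₂ (glue-≡ α))) i p
      ... | no α≢β   = proj₁ (proj₂ (glue-≢ α≢β)) i p

      glue-prerealization : Prerealization glue
      glue-prerealization = record
        { simple  = glue-sym , (λ α → proj₁ (proj₂ (glue-≡ α)))
        ; cross-≢ = λ α β α≢β → proj₁ (glue-≢ α≢β)
        ; cross-≡ = λ α → proj₁ (proj₂ (proj₂ (glue-≡ α)))
        ; spectra = glue-spectra
        }

    module Repair (deg-count : ∀ α → deg α * n α ≡ J α α + ∑ Δ (J α))
                  (s-deg : ∀ α i (p : S α i) → ∑ Δ (s α i p) ≡ deg α) where

      module _ {A : Adj J n} (pre : Prerealization A) where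
        open Prerealization pre

        prescribed-degree : ∀ α i → S α i → degree A (α , i) ≡ deg α
        prescribed-degree α i p = trans (∑-cong Δ (spectra α i p)) (s-deg α i p)

        cross-row : ∀ α β → cross J n A α β ≡ J α β + J α α * δᶠ β α
        cross-row α β with β Fin.≟ α
        ... | yes refl = trans (cross-≡ α) (cong (J α α +_) (trans (+-identityʳ _) (sym (*-identityʳ _))))
        ... | no β≢α   = trans (cross-≢ α β (β≢α ∘ sym))
                               (sym (trans (cong (J α β +_) (*-zeroʳ (J α α))) (+-identityʳ (J α β))))

        -- The cross counts already fix the degree total of each class; only its distribution can be wrong.
        degree-sum : ∀ α → ∑ (n α) (λ i → degree A (α , i)) ≡ ∑ (n α) (λ _ → deg α)
        degree-sum α = begin
          ∑ (n α) (λ i → degree A (α , i))          ≡⟨ ∑-comm (n α) Δ (spectrum J n A α) ⟩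
          ∑ Δ (cross J n A α)                        ≡⟨ ∑-cong Δ (cross-row α) ⟩
          ∑ Δ (λ β → J α β + J α α * δᶠ β α)        ≡⟨ ∑-distrib-+ Δ (J α) _ ⟩
          ∑ Δ (J α) + ∑ Δ (λ β → J α α * δᶠ β α)    ≡⟨ cong (∑ Δ (J α) +_) (∑-distribˡ-* Δ (J α α) _) ⟩
          ∑ Δ (J α) + J α α * ∑ Δ (λ β → δᶠ β α)    ≡⟨ cong (λ t → ∑ Δ (J α) + J α α * t) (∑-δᶠ Δ α) ⟩
          ∑ Δ (J α) + J α α * 1                      ≡⟨ cong (∑ Δ (J α) +_) (*-identityʳ (J α α)) ⟩
          ∑ Δ (J α) + J α α                          ≡⟨ +-comm (∑ Δ (J α)) (J α α) ⟩
          J α α + ∑ Δ (J α)                          ≡⟨ deg-count α ⟨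
          deg α * n α                                ≡⟨ *-comm (deg α) (n α) ⟩
          n α * deg α                                ≡⟨ ∑-const (n α) (deg α) ⟨
          ∑ (n α) (λ _ → deg α)                      ∎

        excess-free⇒realization : total-excess A ≡ 0 → RealizesWithSpectra J n S s A
        excess-free⇒realization no-excess = (simple , degrees , cross-≢ , cross-≡) , spectra
          where
          degree-≤ : ∀ α i → degree A (α , i) ≤ deg α
          degree-≤ α i = m∸n≡0⇒m≤n (n≤0⇒n≡0 (subst (excess A (α , i) ≤_) no-excess
            (≤-trans (∑-term-≤ (n α) _ i) (∑-term-≤ Δ (λ γ → ∑ (n γ) (λ k → excess A (γ , k))) α))))
          degrees : ∀ α i → degree A (α , i) ≡ deg α
          degrees α = ∑-≡-pointwise (n α) (degree-≤ α) (degree-sum α)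

      record Switch (A : Adj J n) : Set where
        field
          {α β}   : Fin Δ
          u v     : Fin (n α)
          w       : Fin (n β)
          u-over  : deg α < degree A (α , u)
          v-under : degree A (α , v) < deg α
          uw-edge : A α β u w ≡ true
          vw-edge : A α β v w ≡ false
          v≢w     : (α , v) ≢ (β , w)

      switch-from : ∀ {A} → Prerealization A → ∀ {α} (u : Fin (n α)) → deg α < degree A (α , u) → Switch A
      switch-from {A} pre {α} u u-over
        with ∑-≡⇒∃< (n α) (λ i → degree A (α , i)) (λ _ → deg α) (degree-sum pre α) u u-over
      ... | v , v-under
        with ∑-<⇒∃< Δ (spectrum J n A α v) (spectrum J n A α u) (<-trans v-under u-over)
      ... | β , more with distinguishing-neighbour A (Prerealization.simple pre) u v β more
      ... | w , uw-edge , vw-edge , v≢w = record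
        { u = u ; v = v ; w = w ; u-over = u-over ; v-under = v-under
        ; uw-edge = uw-edge ; vw-edge = vw-edge ; v≢w = v≢w }

      find-switch : ∀ {A} → Prerealization A → 0 < total-excess A → Switch A
      find-switch pre excess>0 with ∑-pos⇒∃pos Δ _ excess>0
      ... | α , α-excess with ∑-pos⇒∃pos (n α) _ α-excess
      ... | u , u-excess = switch-from pre u (m∸n≢0⇒n<m (≢-sym (<⇒≢ u-excess)))

      module Switching {A : Adj J n} (pre : Prerealization A) (sw : Switch A) where
        open Prerealization pre
        open Switch sw

        U V W : Node
        U = α , u
        V = α , v
        W = β , w

        U≢V : U ≢ V
        U≢V U≡V = <-asym u-over (subst (λ z → degree A z < deg (proj₁ z)) (sym U≡V) v-under)

        U≢W : U ≢ W
        U≢W U≡W = case trans (sym (subst (λ z → edge A U z ≡ true) (sym U≡W) uw-edge)) (proj₂ simple α u)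
                  of λ ()

        A₁ : Adj J n
        A₁ = A [ U ─ W ]≔ false

        simple₁ : IsSimple J n A₁
        simple₁ = update-simple A simple U≢W uw-edge false

        vw-edge₁ : edge A₁ V W ≡ false
        vw-edge₁ = trans (update-elsewhere A simple U≢W uw-edge false W (U≢V ∘ sym) v≢w) vw-edge

        switched : Adj J n
        switched = A₁ [ V ─ W ]≔ true

        degree-switch : ∀ z → degree switched z + δᴺ z U ≡ degree A z + δᴺ z V
        degree-switch z =
          remove-add {degree A z} {degree A₁ z} {degree switched z} (δᴺ z U) (δᴺ z V) (δᴺ z W)
          (degree-update A simple U≢W uw-edge false z)
          (degree-update A₁ simple₁ v≢w vw-edge₁ true z)

        spectrum-switch : ∀ γ i δ → spectrum J n switched γ i δ + δᴺ (γ , i) U * δᶠ δ β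
                                    ≡ spectrum J n A γ i δ + δᴺ (γ , i) V * δᶠ δ β
        spectrum-switch γ i δ =
          remove-add {spectrum J n A γ i δ} {spectrum J n A₁ γ i δ} {spectrum J n switched γ i δ}
            (δᴺ (γ , i) U * δᶠ δ β) (δᴺ (γ , i) V * δᶠ δ β) (δᴺ (γ , i) W * δᶠ δ α)
          (spectrum-update A simple U≢W uw-edge false γ i δ)
          (spectrum-update A₁ simple₁ v≢w vw-edge₁ true γ i δ)

        cross-switch : ∀ γ δ → cross J n switched γ δ ≡ cross J n A γ δ
        cross-switch γ δ = +-cancelʳ-≡ _ _ _
          (remove-add {cross J n A γ δ} {cross J n A₁ γ δ} {cross J n switched γ δ}
            (δᶠ γ α * δᶠ δ β) (δᶠ γ α * δᶠ δ β) (δᶠ γ β * δᶠ δ α)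
          (cross-update A simple U≢W uw-edge false γ δ)
          (cross-update A₁ simple₁ v≢w vw-edge₁ true γ δ))

        spectra-switch : ∀ γ i (p : S γ i) δ → spectrum J n switched γ i δ ≡ s γ i p δ
        spectra-switch γ i p δ = trans (+-cancelʳ-≡ 0 _ _ shifted) (spectra γ i p δ)
          where
          z≢U : (γ , i) ≢ U
          z≢U refl = <-irrefl (sym (prescribed-degree pre α u p)) u-over
          z≢V : (γ , i) ≢ V
          z≢V refl = <-irrefl (prescribed-degree pre α v p) v-under
          shifted : spectrum J n switched γ i δ + 0 ≡ spectrum J n A γ i δ + 0
          shifted = subst₂ (λ a b → spectrum J n switched γ i δ + a * δᶠ δ β
                                    ≡ spectrum J n A γ i δ + b * δᶠ δ β)
                           (kron-≢ _≟ᴺ_ z≢U) (kron-≢ _≟ᴺ_ z≢V) (spectrum-switch γ i δ)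

        excess-switch : ∀ z → excess switched z + δᴺ z U ≡ excess A z
        excess-switch z = by-cases (z ≟ᴺ U) (z ≟ᴺ V)
          where
          shifted : ∀ {a b} → δᴺ z U ≡ a → δᴺ z V ≡ b → degree switched z + a ≡ degree A z + b
          shifted z≈U z≈V =
            subst₂ (λ a b → degree switched z + a ≡ degree A z + b) z≈U z≈V (degree-switch z)

          by-cases : Dec (z ≡ U) → Dec (z ≡ V) → excess switched z + δᴺ z U ≡ excess A z
          by-cases (yes refl) _ = trans (cong (excess switched U +_) (kron-refl _≟ᴺ_ U))
            (∸-step-above u-over (shifted (kron-refl _≟ᴺ_ U) (kron-≢ _≟ᴺ_ U≢V)))
          by-cases (no z≢U) (yes refl) = trans (cong (excess switched V +_) (kron-≢ _≟ᴺ_ z≢U))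
            (∸-step-below v-under (shifted (kron-≢ _≟ᴺ_ z≢U) (kron-refl _≟ᴺ_ V)))
          by-cases (no z≢U) (no z≢V) = trans (cong (excess switched z +_) (kron-≢ _≟ᴺ_ z≢U))
            (trans (+-identityʳ _) (cong (_∸ deg (proj₁ z))
              (+-cancelʳ-≡ 0 _ _ (shifted (kron-≢ _≟ᴺ_ z≢U) (kron-≢ _≟ᴺ_ z≢V)))))

        total-excess-switch : suc (total-excess switched) ≡ total-excess A
        total-excess-switch = begin
          suc (total-excess switched)                ≡⟨ +-comm 1 _ ⟩
          total-excess switched + 1                  ≡⟨ cong (total-excess switched +_) (∑ᴺ-δᴺ U) ⟨
          total-excess switched + ∑ᴺ (λ z → δᴺ z U)  ≡⟨ ∑ᴺ-distrib-+ (excess switched) _ ⟨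
          ∑ᴺ (λ z → excess switched z + δᴺ z U)      ≡⟨ ∑ᴺ-cong excess-switch ⟩
          total-excess A                             ∎

        switched-prerealization : Prerealization switched
        switched-prerealization = record
          { simple  = update-simple A₁ simple₁ v≢w vw-edge₁ true
          ; cross-≢ = λ γ δ γ≢δ → trans (cross-switch γ δ) (cross-≢ γ δ γ≢δ)
          ; cross-≡ = λ γ → trans (cross-switch γ γ) (cross-≡ γ)
          ; spectra = spectra-switch
          }

      realize : ∀ k {A} → Prerealization A → total-excess A ≡ k → ∃ (RealizesWithSpectra J n S s)
      realize zero    pre no-excess  = _ , excess-free⇒realization pre no-excess
      realize (suc k) pre excess≡1+k =
        realize k (Switching.switched-prerealization pre switch)
                  (suc-injective (trans (Switching.total-excess-switch pre switch) excess≡1+k))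
        where
        switch : Switch _
        switch = find-switch pre (subst (0 <_) (sym excess≡1+k) z<s)

theorem3 : (Δ : ℕ) (J : Fin Δ → Fin Δ → ℕ)
    → (∀ α β → J α β ≡ J β α)
    → (n : Fin Δ → ℕ)
    → (∀ α → deg α * n α ≡ J α α + ∑ Δ (J α))
    → (S : (α : Fin Δ) → Fin (n α) → Set)
    → (s : (α : Fin Δ) (i : Fin (n α)) → S α i → Fin Δ → ℕ)
    → (∀ α i (p : S α i) → ∑ Δ (s α i p) ≡ deg α)
    → (∃ (RealizesWithSpectra J n S s))
      ⇔ (∀ α β → LocalGraphExists J n S s α β)
theorem3 Δ J J-sym n deg-count S s s-deg =
  mk⇔ (realization⇒local-graphs J n S s) λ local →
    Repair.realize J n S s deg-count s-deg _ (Gluing.glue-prerealization J n S s J-sym local) refl
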